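{- Let $(E,\mathcal I)$ be a simple matroid with finite ground set $E$ and independent sets $\mathcal I$. Declare the $\phi$-classes to be the flats (closed sets) of the matroid. Then: (1) for every $u\subseteq E$, the $\phi$-common region $\operatorname{cm}_\phi(u)$ equals the matroid closure $\operatorname{cl}(u)$; (2) two subsets $u,v\subseteq E$ are $\phi$-equivalent if and only if $\operatorname{cl}(u)=\operatorname{cl}(v)$; (3) a nonempty subset of $E$ is $\phi$-prime if and only if it is an independent set of the matroid; (4) the $\phi$-dimension number of every nonempty subset of $E$ equals its matroid rank; (5) if $E$ is nonempty, then $E$ is $\phi$-maximal; moreover, every $\phi$-prime set is $\phi$-axial; (6) $(E,\phi)$ is a geometrical system in the generalized sense of Whitehead.
   Context: Whitehead's terminology. Let $E$ be a set and let some subsets of $E$ be designated as $\phi$-classes. For $u\subseteq E$, the $\phi$-common region $\operatorname{cm}_\phi(u)$ is the intersection of all $\phi$-classes containing $u$ (the intersection of the empty family being $E$). Two subsets $u,v\subseteq E$ are $\phi$-equivalent if $\operatorname{cm}_\phi(u)=\operatorname{cm}_\phi(v)$. A nonempty set $u\subseteq E$ is $\phi$-prime if no proper subset of $u$ has the same $\phi$-common region as $u$. A $\phi$-prime set is $\phi$-axial if it has the largest cardinality among all $\phi$-prime sets having the same $\phi$-common region. For nonempty $u\subseteq E$, the $\phi$-dimension number $\dim_\phi(u)$ is the cardinality of a $\phi$-axial set that is $\phi$-equivalent to $u$. A nonempty set $u\subseteq E$ is $\phi$-maximal if every $\phi$-prime subset of $u$ that is $\phi$-equivalent to $u$ is $\phi$-axial.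 $(E,\phi)$ is a geometrical system in the generalized sense of Whitehead if: ($\lambda$) $E$ is a $\phi$-class; ($\mu$) for every $x\in E$ the singleton $\{x\}$ is a $\phi$-class; ($\nu'$) $\dim_\phi(E)$ is finite and $\operatorname{cm}_\phi(\emptyset)=\emptyset$; ($\pi$) for every $u\subseteq E$ and every $\phi$-axial subset $v$ of $\operatorname{cm}_\phi(u)$, there exists $w\subseteq E$ such that $v\cup w$ is $\phi$-axial and $\phi$-equivalent to $u$; ($\rho$) for all $\phi$-axial $u,v\subseteq E$ with $|u\cap v|\ge 2$, the set $u\cup v$ is $\phi$-maximal. A simple matroid is a matroid with no loops and no parallel pairs; $\operatorname{cl}$ denotes the matroid closure operator and flats are sets $F$ with $\operatorname{cl}(F)=F$. -}

module Defs where

open import Data.Nat using (ℕ; zero; suc; _≤_; _<_; _⊔_; _≟_)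
open import Data.Bool using (Bool; true; false)
open import Data.Fin using (Fin)
open import Data.Fin.Subset
  using (Subset; _∈_; _∉_; _⊆_; _⊂_; _∪_; _∩_; ∣_∣; ⁅_⁆; Nonempty; ⊤; ⊥)
open import Data.Fin.Subset.Properties using (_⊆?_)
open import Data.List using (List; []; _∷_; _++_; map; foldr; filter)
open import Data.Vec using (Vec; tabulate)
import Data.Vec
open import Data.Product using (Σ; _×_; ∃; ∃-syntax)
open import Relation.Nullary using (¬_; Dec)
open import Relation.Nullary.Decidable using (⌊_⌋; _×-dec_)
open import Relation.Unary using (Pred; Decidable)
open import Relation.Binary.PropositionalEquality using (_≡_; _≢_)
open import Function.Bundles using (_⇔_)

record Matroid (n : ℕ) : Set₁ where
  field
    Indep     : Subset n → Set
    indep?    : Decidable Indep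
    indep-⊥   : Indep ⊥
    indep-⊆   : ∀ {I J} → J ⊆ I → Indep I → Indep J
    indep-aug : ∀ {I J} → Indep I → Indep J → ∣ I ∣ < ∣ J ∣ →
                ∃[ x ] (x ∈ J × x ∉ I × Indep (I ∪ ⁅ x ⁆))

allSubsets : (n : ℕ) → List (Subset n)
allSubsets zero    = Data.Vec.[] ∷ []
allSubsets (suc n) =
  map (false Data.Vec.∷_) (allSubsets n) ++ map (true Data.Vec.∷_) (allSubsets n)

module _ {n : ℕ} (M : Matroid n) where
  open Matroid M

  rank : Subset n → ℕ
  rank X = foldr _⊔_ 0
    (map ∣_∣ (filter (λ I → (I ⊆? X) ×-dec indep? I) (allSubsets n)))

  cl : Subset n → Subset n
  cl X = tabulate (λ x → ⌊ rank (X ∪ ⁅ x ⁆) ≟ rank X ⌋)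

  Flat : Subset n → Set
  Flat F = cl F ≡ F

  Simple : Set
  Simple = (∀ x → Indep ⁅ x ⁆) × (∀ x y → x ≢ y → Indep (⁅ x ⁆ ∪ ⁅ y ⁆))

module Whitehead {n : ℕ} (φ : Subset n → Set) where

  -- membership in the φ-common region cm_φ(u): intersection of all
  -- φ-classes containing u (the empty intersection being E)
  Cm : Subset n → Pred (Fin n) _
  Cm u x = ∀ C → φ C → u ⊆ C → x ∈ C

  Equiv : Subset n → Subset n → Set
  Equiv u v = ∀ x → Cm u x ⇔ Cm v x

  Prime : Subset n → Set
  Prime u = Nonempty u × (∀ v → v ⊂ u → ¬ Equiv v u)

  Axial : Subset n → Set
  Axial u = Prime u × (∀ v → Prime v → Equiv v u → ∣ v ∣ ≤ ∣ u ∣)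

  HasDim : Subset n → ℕ → Set
  HasDim u k = Σ (Subset n) λ v → Axial v × Equiv v u × ∣ v ∣ ≡ k

  Maximal : Subset n → Set
  Maximal u = Nonempty u ×
    (∀ v → v ⊆ u → Prime v → Equiv v u → Axial v)

  record GeometricalSystem : Set where
    field
      λ-ax : φ ⊤
      μ-ax : ∀ x → φ ⁅ x ⁆
      ν-dim : Nonempty {n} ⊤ → ∃[ k ] HasDim ⊤ k
      ν-cm  : ∀ x → ¬ Cm ⊥ x
      π-ax : ∀ u v → Axial v → (∀ x → x ∈ v → Cm u x) →
             ∃[ w ] (Axial (v ∪ w) × Equiv (v ∪ w) u)
      ρ-ax : ∀ u v → Axial u → Axial v → 2 ≤ ∣ u ∩ v ∣ → Maximal (u ∪ v)

-- The flats are exactly the fixed points of cl, and cl u is itself a flat containing u,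
-- so the φ-common region of u is the least flat containing u, namely cl u.  A set is then
-- φ-prime iff it is a minimal set spanning its closure, i.e. iff it is independent, and all
-- independent sets with the same closure are bases of that flat and so have its rank as
-- cardinality: every φ-prime set is φ-axial and dimension numbers are ranks.  Whitehead's
-- axioms follow, simplicity being used only to make ∅ and the singletons flats and to give
-- every nonempty set a nonempty basis.
module Submission where

open import Defs
open import Data.Nat using (ℕ; _≤_)
open import Data.Fin using (Fin)
open import Data.Fin.Subset using (Subset; _∈_; ∣_∣; Nonempty; ⊤)
open import Data.Product using (_×_; Σ)
open import Function.Bundles using (_⇔_)
open import Relation.Binary.PropositionalEquality using (_≡_)

open import Data.Bool using (true; false)
open import Data.Bool.Properties using (T-≡)
open import Data.Empty using (⊥-elim)
import Data.Fin as Fin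
open import Data.Fin.Properties using (¬∀⟶∃¬)
open import Data.Fin.Subset using (_∉_; _⊆_; _⊂_; _∪_; ⁅_⁆; ⊥)
open import Data.Fin.Subset.Properties
  using (_⊆?_; _∈?_; ∉⊥; ∈⊤; x∈⁅x⁆; x∈⁅y⁆⇒x≡y; ⊆-refl; ⊆-antisym;
         p⊆p∪q; q⊆p∪q; p⊆q⇒∣p∣≤∣q∣; x∈p∪q⁻; ∪-identityˡ; ∪-identityʳ; ∣⊥∣≡0)
open import Data.List using (map; foldr; filter)
import Data.List.Membership.Propositional as List
open import Data.List.Membership.Propositional.Properties
  using (∈-++⁺ˡ; ∈-++⁺ʳ; ∈-map⁺; ∈-map⁻; ∈-filter⁺; ∈-filter⁻; foldr-selective)
open import Data.List.Properties using (foldr-preservesᵒ)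
import Data.List.Relation.Unary.Any as Any
open import Data.Nat using (zero; suc; _<_; _⊔_; _+_; _≟_; z<s)
open import Data.Nat.Properties
  using (⊔-sel; m≤n⇒m≤n⊔o; m≤n⇒m≤o⊔n; ≤-reflexive; ≤-antisym; <-irrefl;
         ≮⇒≥; ≤∧≢⇒<; +-suc; m<n+m; m∸n+n≡m)
open import Data.Product using (_,_; proj₁; proj₂; ∃-syntax)
open import Data.Sum using (inj₁; inj₂; [_,_])
open import Data.Vec using (_∷_; [])
open import Data.Vec.Properties using (lookup∘tabulate; []=⇒lookup; lookup⇒[]=)
open import Function.Base using (_∘_; case_of_)
open import Function.Bundles using (mk⇔; Equivalence)
import Function.Properties.Equivalence as ⇔
open import Relation.Nullary using (¬_; yes; no)
open import Relation.Nullary.Decidable using (_×-dec_; _→-dec_; toWitness; fromWitness)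
open import Relation.Binary.PropositionalEquality
  using (refl; sym; trans; cong; subst; subst₂; module ≡-Reasoning)

open Equivalence using (to; from)

≤-foldr-⊔ : ∀ {m ms} → m List.∈ ms → m ≤ foldr _⊔_ 0 ms
≤-foldr-⊔ m∈ms =
  foldr-preservesᵒ (λ a b → [ m≤n⇒m≤n⊔o b , m≤n⇒m≤o⊔n a ]) 0 _
    (inj₂ (Any.map ≤-reflexive m∈ms))

∈-allSubsets : ∀ {n} (p : Subset n) → p List.∈ allSubsets n
∈-allSubsets []            = Any.here refl
∈-allSubsets (false ∷ p)   = ∈-++⁺ˡ (∈-map⁺ (false ∷_) (∈-allSubsets p))
∈-allSubsets {suc n} (true ∷ p) =
  ∈-++⁺ʳ (map (false ∷_) (allSubsets n)) (∈-map⁺ (true ∷_) (∈-allSubsets p))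

x∉p⇒∣p∪⁅x⁆∣≡1+∣p∣ : ∀ {n} {p : Subset n} {x} → x ∉ p → ∣ p ∪ ⁅ x ⁆ ∣ ≡ suc ∣ p ∣
x∉p⇒∣p∪⁅x⁆∣≡1+∣p∣ {p = true  ∷ p} {Fin.zero}  x∉p = ⊥-elim (x∉p Data.Vec.here)
x∉p⇒∣p∪⁅x⁆∣≡1+∣p∣ {p = false ∷ p} {Fin.zero}  x∉p = cong (suc ∘ ∣_∣) (∪-identityʳ p)
x∉p⇒∣p∪⁅x⁆∣≡1+∣p∣ {p = true  ∷ p} {Fin.suc x} x∉p =
  cong suc (x∉p⇒∣p∪⁅x⁆∣≡1+∣p∣ (x∉p ∘ Data.Vec.there))
x∉p⇒∣p∪⁅x⁆∣≡1+∣p∣ {p = false ∷ p} {Fin.suc x} x∉p =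
  x∉p⇒∣p∪⁅x⁆∣≡1+∣p∣ (x∉p ∘ Data.Vec.there)

∪-lub : ∀ {n} {p q r : Subset n} → p ⊆ r → q ⊆ r → p ∪ q ⊆ r
∪-lub {p = p} {q} p⊆r q⊆r x∈p∪q = [ p⊆r , q⊆r ] (x∈p∪q⁻ p q x∈p∪q)

x∈p⇒⁅x⁆⊆p : ∀ {n} {p : Subset n} {x} → x ∈ p → ⁅ x ⁆ ⊆ p
x∈p⇒⁅x⁆⊆p {x = x} x∈p y∈⁅x⁆ = subst (_∈ _) (sym (x∈⁅y⁆⇒x≡y x y∈⁅x⁆)) x∈p

p∪⁅x⁆⊆q : ∀ {n} {p q : Subset n} {x} → p ⊆ q → x ∈ q → p ∪ ⁅ x ⁆ ⊆ q
p∪⁅x⁆⊆q p⊆q x∈q = ∪-lub p⊆q (x∈p⇒⁅x⁆⊆p x∈q)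

p⊆q⇒p∪q≡q : ∀ {n} {p q : Subset n} → p ⊆ q → p ∪ q ≡ q
p⊆q⇒p∪q≡q {q = q} p⊆q = ⊆-antisym (∪-lub p⊆q ⊆-refl) (q⊆p∪q _ q)

∪-monoˡ-⊆ : ∀ {n} {p q r : Subset n} → p ⊆ q → p ∪ r ⊆ q ∪ r
∪-monoˡ-⊆ {r = r} p⊆q = ∪-lub (p⊆p∪q r ∘ p⊆q) (q⊆p∪q _ r)

⊆∧⊈⇒⊂ : ∀ {n} {p q : Subset n} → p ⊆ q → ¬ q ⊆ p → p ⊂ q
⊆∧⊈⇒⊂ {n} {p} {q} p⊆q q⊈p with ¬∀⟶∃¬ n (λ x → x ∈ q → x ∈ p) (λ x → (x ∈? q) →-dec (x ∈? p))
                                       (λ q⊆p → q⊈p (q⊆p _))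
... | x , x∈q⇏x∈p with x ∈? q
...   | yes x∈q = p⊆q , x , x∈q , λ x∈p → x∈q⇏x∈p (λ _ → x∈p)
...   | no  x∉q = ⊥-elim (x∈q⇏x∈p (⊥-elim ∘ x∉q))

module _ {n : ℕ} (M : Matroid n) where
  open Matroid M

  Basis : Subset n → Subset n → Set
  Basis X B = B ⊆ X × Indep B × ∣ B ∣ ≡ rank M X

  Loopless : Set
  Loopless = ∀ x → Indep ⁅ x ⁆

  ∣I∣≤rank : ∀ {X I} → I ⊆ X → Indep I → ∣ I ∣ ≤ rank M X
  ∣I∣≤rank {X} {I} I⊆X indI =
    ≤-foldr-⊔ (∈-map⁺ ∣_∣ (∈-filter⁺ (λ J → (J ⊆? X) ×-dec indep? J) (∈-allSubsets I) (I⊆X , indI)))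

  basis-exists : ∀ X → ∃[ B ] Basis X B
  basis-exists X with foldr-selective ⊔-sel 0 (map ∣_∣ (filter (λ I → (I ⊆? X) ×-dec indep? I) (allSubsets n)))
  ... | inj₁ rank≡0 = ⊥ , ⊥-elim ∘ ∉⊥ , indep-⊥ , trans (∣⊥∣≡0 n) (sym rank≡0)
  ... | inj₂ rank∈ with ∈-map⁻ ∣_∣ rank∈
  ...   | I , I∈ , rank≡∣I∣ with ∈-filter⁻ (λ J → (J ⊆? X) ×-dec indep? J) {xs = allSubsets n} I∈
  ...     | _ , I⊆X , indI = I , I⊆X , indI , sym rank≡∣I∣

  ∣B∣<rank : ∀ {Y B x} → x ∉ B → B ∪ ⁅ x ⁆ ⊆ Y → Indep (B ∪ ⁅ x ⁆) → ∣ B ∣ < rank M Y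
  ∣B∣<rank x∉B Bx⊆Y indBx = subst (_≤ _) (x∉p⇒∣p∪⁅x⁆∣≡1+∣p∣ x∉B) (∣I∣≤rank Bx⊆Y indBx)

  extend-to-basis-by : ∀ {X} k {I} → I ⊆ X → Indep I → rank M X ≡ k + ∣ I ∣ →
                       ∃[ B ] (I ⊆ B × Basis X B)
  extend-to-basis-by zero    {I} I⊆X indI r≡ = I , ⊆-refl , I⊆X , indI , sym r≡
  extend-to-basis-by {X} (suc k) {I} I⊆X indI r≡ with basis-exists X
  ... | J , J⊆X , indJ , ∣J∣≡r
    with indep-aug indI indJ (subst (∣ I ∣ <_) (sym (trans ∣J∣≡r r≡)) (m<n+m ∣ I ∣ z<s))
  ...   | x , x∈J , x∉I , indIx
    with extend-to-basis-by k (p∪⁅x⁆⊆q I⊆X (J⊆X x∈J)) indIx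
           (trans r≡ (trans (sym (+-suc k ∣ I ∣)) (cong (k +_) (sym (x∉p⇒∣p∪⁅x⁆∣≡1+∣p∣ x∉I)))))
  ...     | B , Ix⊆B , basis = B , Ix⊆B ∘ p⊆p∪q _ , basis

  extend-to-basis : ∀ {X I} → I ⊆ X → Indep I → ∃[ B ] (I ⊆ B × Basis X B)
  extend-to-basis I⊆X indI =
    extend-to-basis-by _ I⊆X indI (sym (m∸n+n≡m (∣I∣≤rank I⊆X indI)))

  rank-mono : ∀ {X Y} → X ⊆ Y → rank M X ≤ rank M Y
  rank-mono {X} X⊆Y with basis-exists X
  ... | B , B⊆X , indB , ∣B∣≡r = subst (_≤ _) ∣B∣≡r (∣I∣≤rank (X⊆Y ∘ B⊆X) indB)

  indep⇒basis : ∀ {I} → Indep I → Basis I I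
  indep⇒basis {I} indI with basis-exists I
  ... | B , B⊆I , indB , ∣B∣≡r =
    ⊆-refl , indI , ≤-antisym (∣I∣≤rank ⊆-refl indI) (subst (_≤ ∣ I ∣) ∣B∣≡r (p⊆q⇒∣p∣≤∣q∣ B⊆I))

  ∈cl⇔rank≡ : ∀ {X x} → x ∈ cl M X ⇔ rank M (X ∪ ⁅ x ⁆) ≡ rank M X
  ∈cl⇔rank≡ {X} {x} = mk⇔
    (λ x∈cl → toWitness {a? = r≟} (from T-≡ (trans (sym (lookup∘tabulate _ x)) ([]=⇒lookup x∈cl))))
    (λ r≡ → lookup⇒[]= x (cl M X) (trans (lookup∘tabulate _ x) (to T-≡ (fromWitness {a? = r≟} r≡))))
    where r≟ = rank M (X ∪ ⁅ x ⁆) ≟ rank M X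

  cl-extensive : ∀ {X} → X ⊆ cl M X
  cl-extensive x∈X =
    from ∈cl⇔rank≡ (≤-antisym (rank-mono (p∪⁅x⁆⊆q ⊆-refl x∈X)) (rank-mono (p⊆p∪q _)))

  basis-∪⁅x⁆⇒∉cl : ∀ {X B x} → Basis X B → x ∉ B → Indep (B ∪ ⁅ x ⁆) → x ∉ cl M X
  basis-∪⁅x⁆⇒∉cl (B⊆X , _ , ∣B∣≡r) x∉B indBx x∈cl =
    <-irrefl (trans ∣B∣≡r (sym (to ∈cl⇔rank≡ x∈cl))) (∣B∣<rank x∉B (∪-monoˡ-⊆ B⊆X) indBx)

  -- Adding x ∉ cl X raises the rank, so augmenting B from a basis of X ∪ {x} must use x.
  ∉cl⇒basis-∪⁅x⁆ : ∀ {X B x} → Basis X B → x ∉ cl M X → Indep (B ∪ ⁅ x ⁆)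
  ∉cl⇒basis-∪⁅x⁆ {X} {B} {x} (B⊆X , indB , ∣B∣≡r) x∉cl with basis-exists (X ∪ ⁅ x ⁆)
  ... | J , J⊆Xx , indJ , ∣J∣≡r′
    with indep-aug indB indJ
           (subst₂ _<_ (sym ∣B∣≡r) (sym ∣J∣≡r′)
             (≤∧≢⇒< (rank-mono (p⊆p∪q _)) (x∉cl ∘ from ∈cl⇔rank≡ ∘ sym)))
  ...   | y , y∈J , y∉B , indBy with x∈p∪q⁻ X ⁅ x ⁆ (J⊆Xx y∈J)
  ...     | inj₁ y∈X = ⊥-elim (<-irrefl ∣B∣≡r (∣B∣<rank y∉B (p∪⁅x⁆⊆q B⊆X y∈X) indBy))
  ...     | inj₂ y∈⁅x⁆ = subst (λ z → Indep (B ∪ ⁅ z ⁆)) (x∈⁅y⁆⇒x≡y x y∈⁅x⁆) indBy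

  basis⇒basis-cl : ∀ {X B} → Basis X B → Basis (cl M X) B
  basis⇒basis-cl {X} {B} basisB@(B⊆X , indB , _) =
    B⊆clX , indB , ≤-antisym (∣I∣≤rank B⊆clX indB) (≮⇒≥ ∣B∣≮rank)
    where
    B⊆clX : B ⊆ cl M X
    B⊆clX = cl-extensive ∘ B⊆X

    ∣B∣≮rank : ¬ ∣ B ∣ < rank M (cl M X)
    ∣B∣≮rank ∣B∣<r with basis-exists (cl M X)
    ... | J , J⊆clX , indJ , ∣J∣≡r with indep-aug indB indJ (subst (∣ B ∣ <_) (sym ∣J∣≡r) ∣B∣<r)
    ... | y , y∈J , y∉B , indBy = basis-∪⁅x⁆⇒∉cl basisB y∉B indBy (J⊆clX y∈J)

  basis-⊆⇒cl-⊆ : ∀ {X Y B B′} → Basis X B → Basis Y B′ → B ⊆ B′ → cl M X ⊆ cl M Y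
  basis-⊆⇒cl-⊆ {Y = Y} {B} {B′} basisB basisB′@(B′⊆Y , _) B⊆B′ {x} x∈clX with x ∈? cl M Y
  ... | yes x∈clY = x∈clY
  ... | no  x∉clY = ⊥-elim (basis-∪⁅x⁆⇒∉cl basisB x∉B
                             (indep-⊆ (∪-monoˡ-⊆ B⊆B′) (∉cl⇒basis-∪⁅x⁆ basisB′ x∉clY)) x∈clX)
    where
    x∉B : x ∉ B
    x∉B = x∉clY ∘ cl-extensive ∘ B′⊆Y ∘ B⊆B′

  cl-mono : ∀ {X Y} → X ⊆ Y → cl M X ⊆ cl M Y
  cl-mono {X} X⊆Y with basis-exists X
  ... | B , basisB@(B⊆X , indB , _) with extend-to-basis (X⊆Y ∘ B⊆X) indB
  ...   | B′ , B⊆B′ , basisB′ = basis-⊆⇒cl-⊆ basisB basisB′ B⊆B′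

  cl-idem : ∀ {X} → cl M (cl M X) ⊆ cl M X
  cl-idem {X} = basis-⊆⇒cl-⊆ (basis⇒basis-cl basisX) basisX ⊆-refl
    where basisX = proj₂ (basis-exists X)

  cl-basis : ∀ {X B} → Basis X B → cl M B ≡ cl M X
  cl-basis basisB@(_ , indB , _) =
    ⊆-antisym (basis-⊆⇒cl-⊆ (indep⇒basis indB) basisB ⊆-refl)
              (basis-⊆⇒cl-⊆ basisB (indep⇒basis indB) ⊆-refl)

  cl≡⇒∣≡∣ : ∀ {I J} → Indep I → Indep J → cl M I ≡ cl M J → ∣ I ∣ ≡ ∣ J ∣
  cl≡⇒∣≡∣ {I} {J} indI indJ clI≡clJ = begin
    ∣ I ∣               ≡⟨ ∣basis∣≡rank-cl indI ⟩
    rank M (cl M I)     ≡⟨ cong (rank M) clI≡clJ ⟩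
    rank M (cl M J)     ≡⟨ ∣basis∣≡rank-cl indJ ⟨
    ∣ J ∣               ∎
    where
    open ≡-Reasoning
    ∣basis∣≡rank-cl : ∀ {I} → Indep I → ∣ I ∣ ≡ rank M (cl M I)
    ∣basis∣≡rank-cl = proj₂ ∘ proj₂ ∘ basis⇒basis-cl ∘ indep⇒basis

  cl⊆⇒flat : ∀ {F} → cl M F ⊆ F → Flat M F
  cl⊆⇒flat clF⊆F = ⊆-antisym clF⊆F cl-extensive

  flat-cl : ∀ X → Flat M (cl M X)
  flat-cl X = cl⊆⇒flat cl-idem

  flat-⊤ : Flat M ⊤
  flat-⊤ = cl⊆⇒flat (λ _ → ∈⊤)

  loopless⇒flat-⊥ : Loopless → Flat M ⊥
  loopless⇒flat-⊥ loopless = cl⊆⇒flat λ {x} → ⊥-elim ∘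
    basis-∪⁅x⁆⇒∉cl (indep⇒basis indep-⊥) ∉⊥ (subst Indep (sym (∪-identityˡ ⁅ x ⁆)) (loopless x))

  simple⇒flat-⁅x⁆ : Simple M → ∀ x → Flat M ⁅ x ⁆
  simple⇒flat-⁅x⁆ (loopless , noParallel) x = cl⊆⇒flat λ {y} y∈cl → case y Fin.≟ x of λ where
      (yes refl) → x∈⁅x⁆ x
      (no  y≢x)  → ⊥-elim (basis-∪⁅x⁆⇒∉cl (indep⇒basis (loopless x)) (y≢x ∘ x∈⁅y⁆⇒x≡y x)
                                           (noParallel x y (y≢x ∘ sym)) y∈cl)

  open Whitehead (Flat M)

  Cm⇔∈cl : ∀ u x → Cm u x ⇔ x ∈ cl M u
  Cm⇔∈cl u x = mk⇔ (λ x∈cm → x∈cm (cl M u) (flat-cl u) cl-extensive) ∈cl⇒Cm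
    where
    ∈cl⇒Cm : x ∈ cl M u → Cm u x
    ∈cl⇒Cm x∈cl C flatC u⊆C = subst (x ∈_) flatC (cl-mono {u} {C} u⊆C x∈cl)

  Equiv⇔cl≡ : ∀ u v → Equiv u v ⇔ (cl M u ≡ cl M v)
  Equiv⇔cl≡ u v = mk⇔
    (λ u~v → ⊆-antisym (λ {x} → to (Cm⇔∈cl v x) ∘ to (u~v x) ∘ from (Cm⇔∈cl u x))
                       (λ {x} → to (Cm⇔∈cl u x) ∘ from (u~v x) ∘ from (Cm⇔∈cl v x)))
    (λ clu≡clv x → ⇔.trans (subst (λ c → Cm u x ⇔ x ∈ c) clu≡clv (Cm⇔∈cl u x))
                           (⇔.sym (Cm⇔∈cl v x)))

  cl≡⇒Equiv : ∀ {u v} → cl M u ≡ cl M v → Equiv u v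
  cl≡⇒Equiv = from (Equiv⇔cl≡ _ _)

  Equiv⇒cl≡ : ∀ {u v} → Equiv u v → cl M u ≡ cl M v
  Equiv⇒cl≡ = to (Equiv⇔cl≡ _ _)

  indep⇒prime : ∀ {u} → Nonempty u → Indep u → Prime u
  indep⇒prime nonempty indU = nonempty , λ where
    v (v⊆u , x , x∈u , x∉v) v~u →
      basis-∪⁅x⁆⇒∉cl (indep⇒basis (indep-⊆ v⊆u indU)) x∉v (indep-⊆ (p∪⁅x⁆⊆q v⊆u x∈u) indU)
        (subst (x ∈_) (sym (Equiv⇒cl≡ v~u)) (cl-extensive x∈u))

  prime⇒indep : ∀ {u} → Prime u → Indep u
  prime⇒indep {u} (_ , minimal) with basis-exists u
  ... | B , basisB@(B⊆u , indB , _) with u ⊆? B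
  ...   | yes u⊆B = indep-⊆ u⊆B indB
  ...   | no  u⊈B = ⊥-elim (minimal B (⊆∧⊈⇒⊂ B⊆u u⊈B) (cl≡⇒Equiv (cl-basis basisB)))

  prime⇒axial : ∀ {u} → Prime u → Axial u
  prime⇒axial primeU = primeU , λ v primeV v~u →
    ≤-reflexive (cl≡⇒∣≡∣ (prime⇒indep primeV) (prime⇒indep primeU) (Equiv⇒cl≡ v~u))

  nonempty⇒maximal : ∀ {u} → Nonempty u → Maximal u
  nonempty⇒maximal nonempty = nonempty , λ _ _ primeV _ → prime⇒axial primeV

  loopless⇒HasDim-rank : Loopless → ∀ {u} → Nonempty u → HasDim u (rank M u)
  loopless⇒HasDim-rank loopless {u} (x , x∈u)
    with extend-to-basis {u} {⁅ x ⁆} (x∈p⇒⁅x⁆⊆p x∈u) (loopless x)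
  ... | B , x⊆B , basisB@(_ , indB , ∣B∣≡r) =
    B , prime⇒axial (indep⇒prime (x , x⊆B (x∈⁅x⁆ x)) indB) , cl≡⇒Equiv (cl-basis basisB) , ∣B∣≡r

  HasDim⇒≡rank : ∀ {u k} → HasDim u k → k ≡ rank M u
  HasDim⇒≡rank {u} (v , (primeV , _) , v~u , ∣v∣≡k) with basis-exists u
  ... | B , basisB@(_ , indB , ∣B∣≡r) = begin
    _       ≡⟨ ∣v∣≡k ⟨
    ∣ v ∣   ≡⟨ cl≡⇒∣≡∣ (prime⇒indep primeV) indB (trans (Equiv⇒cl≡ v~u) (sym (cl-basis basisB))) ⟩
    ∣ B ∣   ≡⟨ ∣B∣≡r ⟩
    _       ∎
    where open ≡-Reasoning

  basis-cl⇒axial×Equiv : ∀ {u B} → Nonempty B → Basis (cl M u) B → Axial B × Equiv B u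
  basis-cl⇒axial×Equiv {u} nonempty basisB@(_ , indB , _) =
    prime⇒axial (indep⇒prime nonempty indB) , cl≡⇒Equiv (trans (cl-basis basisB) (flat-cl u))

  axial-completion : ∀ u v → Axial v → (∀ x → x ∈ v → Cm u x) →
                     ∃[ w ] (Axial (v ∪ w) × Equiv (v ∪ w) u)
  axial-completion u v (primeV@((x , x∈v) , _) , _) v⊆cm =
    let B , v⊆B , basisB = extend-to-basis {cl M u} {v} v⊆clu (prime⇒indep primeV)
    in B , subst (λ w → Axial w × Equiv w u) (sym (p⊆q⇒p∪q≡q v⊆B))
                 (basis-cl⇒axial×Equiv {u} (x , v⊆B x∈v) basisB)
    where
    v⊆clu : v ⊆ cl M u
    v⊆clu {y} = to (Cm⇔∈cl u y) ∘ v⊆cm y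

  simple⇒geometricalSystem : Simple M → GeometricalSystem
  simple⇒geometricalSystem simple@(loopless , _) = record
    { λ-ax  = flat-⊤
    ; μ-ax  = simple⇒flat-⁅x⁆ simple
    ; ν-dim = λ nonempty → rank M ⊤ , loopless⇒HasDim-rank loopless nonempty
    ; ν-cm  = λ x x∈cm → ∉⊥ (x∈cm ⊥ (loopless⇒flat-⊥ loopless) ⊆-refl)
    ; π-ax  = axial-completion
    ; ρ-ax  = λ u v ((nonemptyU , _) , _) _ _ →
                nonempty⇒maximal (proj₁ nonemptyU , p⊆p∪q v (proj₂ nonemptyU))
    }

theorem2 : {n : ℕ} (M : Matroid n) → Simple M →
    let open Whitehead (Flat M) in
    (∀ u x → Cm u x ⇔ x ∈ cl M u)
    × (∀ u v → Equiv u v ⇔ (cl M u ≡ cl M v))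
    × (∀ u → Nonempty u → Prime u ⇔ Matroid.Indep M u)
    × (∀ u → Nonempty u →
         HasDim u (rank M u) × (∀ k → HasDim u k → k ≡ rank M u))
    × ((Nonempty {n} ⊤ → Maximal ⊤) × (∀ u → Prime u → Axial u))
    × GeometricalSystem
theorem2 M simple@(loopless , _) =
    Cm⇔∈cl M
  , Equiv⇔cl≡ M
  , (λ u nonempty → mk⇔ (prime⇒indep M) (indep⇒prime M nonempty))
  , (λ u nonempty → loopless⇒HasDim-rank M loopless nonempty , λ k → HasDim⇒≡rank M)
  , (nonempty⇒maximal M , λ u → prime⇒axial M)
  , simple⇒geometricalSystem M simple
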